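{- Let $(\prec_x)_{x\in S}$ be a 3-concordant ranking system on a set $S$ of $n$ objects, with friend sets $\Gamma(x)$ satisfying $|\Gamma(x)|\le K$ for all $x\in S$. Then the number of $\Gamma$-pertinent 2-simplices does not exceed $nK^2$.
   Context: Ranking system. For each $x\in S$, $\prec_x$ is a strict total order on $S\setminus\{x\}$. It is 3-concordant if there are no distinct $x,y,z\in S$ with $y\prec_x z$, $z\prec_y x$ and $x\prec_z y$. Friend sets. $\Gamma(x)\subseteq S\setminus\{x\}$, and every element of $\Gamma(x)$ precedes, under $\prec_x$, every element of $S\setminus(\Gamma(x)\cup\{x\})$. Pertinent simplices. Let $\mathcal{U}_\Gamma=\{\{x,y\}:y\in\Gamma(x)\}$. A 2-simplex $\{xy,yz,xz\}$ is identified with the unordered triple $\{x,y,z\}$ of distinct objects. It is $\Gamma$-pertinent if: - $\{x,y\},\{y,z\},\{x,z\}\in\mathcal{U}_\Gamma$, and - each of $\{y,z\}\cap\Gamma(x)$, $\{x,y\}\cap\Gamma(z)$ and $\{x,z\}\cap\Gamma(y)$ is nonempty. -}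

module Defs where

open import Data.Nat using (ℕ; zero; suc; _+_; _<_)
import Data.Fin as Fin
open Fin using (Fin; toℕ)
open import Data.Fin.Subset using (Subset; _∈_; _∉_; ∣_∣)
open import Data.Fin.Subset.Properties using (_∈?_)
open import Data.Product using (_×_; Σ; _,_)
open import Data.Sum using (_⊎_)
open import Data.Empty using (⊥)
open import Relation.Nullary using (¬_; Dec; yes; no)
open import Relation.Nullary.Decidable using (_×-dec_; _⊎-dec_)
open import Data.Fin.Properties using (_<?_)
open import Relation.Binary.PropositionalEquality using (_≡_; _≢_)

record RankingSystem (n : ℕ) : Set₁ where
  field
    _≺[_]_  : Fin n → Fin n → Fin n → Set
    dom     : ∀ {x y z} → y ≺[ x ] z → (y ≢ x) × (z ≢ x)
    irrefl  : ∀ {x y} → ¬ (y ≺[ x ] y)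
    trans   : ∀ {x y z w} → y ≺[ x ] z → z ≺[ x ] w → y ≺[ x ] w
    total   : ∀ x y z → y ≢ x → z ≢ x → y ≢ z → (y ≺[ x ] z) ⊎ (z ≺[ x ] y)
open RankingSystem public

ThreeConcordant : ∀ {n} → RankingSystem n → Set
ThreeConcordant R = ∀ x y z → x ≢ y → y ≢ z → x ≢ z →
  ¬ ((_≺[_]_ R y x z) × (_≺[_]_ R z y x) × (_≺[_]_ R x z y))

-- Friend sets Γ(x) ⊆ S ∖ {x}, forming an initial segment of ≺_x.
IsFriendSets : ∀ {n} → RankingSystem n → (Fin n → Subset n) → Set
IsFriendSets R Γ =
  (∀ x → x ∉ Γ x) ×
  (∀ x y z → y ∈ Γ x → z ∉ Γ x → z ≢ x → _≺[_]_ R y x z)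

InU : ∀ {n} → (Fin n → Subset n) → Fin n → Fin n → Set
InU Γ x y = (y ∈ Γ x) ⊎ (x ∈ Γ y)

-- Γ-pertinence of the triple {x,y,z} (x,y,z assumed distinct).
Pertinent : ∀ {n} → (Fin n → Subset n) → Fin n → Fin n → Fin n → Set
Pertinent Γ x y z =
  (InU Γ x y × InU Γ y z × InU Γ x z) ×
  ((y ∈ Γ x ⊎ z ∈ Γ x) × (x ∈ Γ z ⊎ y ∈ Γ z) × (x ∈ Γ y ⊎ z ∈ Γ y))

pertinent? : ∀ {n} (Γ : Fin n → Subset n) x y z → Dec (Pertinent Γ x y z)
pertinent? Γ x y z =
  (((y ∈? Γ x) ⊎-dec (x ∈? Γ y)) ×-dec ((z ∈? Γ y) ⊎-dec (y ∈? Γ z))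
     ×-dec ((z ∈? Γ x) ⊎-dec (x ∈? Γ z)))
  ×-dec (((y ∈? Γ x) ⊎-dec (z ∈? Γ x)) ×-dec ((x ∈? Γ z) ⊎-dec (y ∈? Γ z))
     ×-dec ((x ∈? Γ y) ⊎-dec (z ∈? Γ y)))

count : ∀ {n} {P : Fin n → Set} → (∀ i → Dec (P i)) → ℕ
count {zero} d = 0
count {suc n} d with d Fin.zero
... | yes _ = suc (count (λ i → d (Fin.suc i)))
... | no  _ = count (λ i → d (Fin.suc i))

sumFin : ∀ {n} → (Fin n → ℕ) → ℕ
sumFin {zero} f = 0
sumFin {suc n} f = f Fin.zero + sumFin (λ i → f (Fin.suc i))

-- Number of Γ-pertinent 2-simplices: each unordered triple {x,y,z} of
-- distinct objects is counted exactly once, as x < y < z.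
numPertinent : ∀ {n} → (Fin n → Subset n) → ℕ
numPertinent Γ = sumFin λ x → sumFin λ y → count λ z →
  (x <? y) ×-dec (y <? z) ×-dec pertinent? Γ x y z

-- Every pertinent triangle {x,y,z} has a centre: a vertex whose friend set
-- contains the other two. Each vertex has a friend in the triangle and each
-- edge is in U_Γ, so a triangle without a centre is a friendship 3-cycle
-- x → y → z → x in which no vertex befriends its predecessor; friend sets
-- being initial segments, this gives y ≺ₓ z, z ≺ᵧ x, x ≺_z y, which
-- 3-concordance forbids. Charging every increasing pertinent triple to its
-- centre w and the two friends of w it contains is at most one-to-one, so
-- there are at most Σ_w |Γ(w)|² ≤ nK² pertinent triangles.
module Submission where

open import Defs hiding (trans)
open import Data.Nat using (ℕ; _≤_; _*_)
open import Data.Fin using (Fin)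
open import Data.Fin.Subset using (Subset; ∣_∣)

open import Data.Nat using (zero; suc; _+_; z≤n; s≤s)
open import Data.Bool using (if_then_else_)
open import Data.Nat.Properties
  using ( +-*-semiring; +-mono-≤; *-mono-≤; *-monoˡ-≤; *-identityˡ; +-identityʳ
        ; *-distribˡ-+; *-distribʳ-+; m≤m+n; m≤n+m; ≤-trans; ≤-reflexive; module ≤-Reasoning)
import Data.Fin as Fin
open import Data.Fin.Properties using (_<?_; <-asym; <-trans; <⇒≢)
open import Data.Fin.Subset using (_∈_; _∉_; inside; outside)
open import Data.Fin.Subset.Properties using (_∈?_)
open import Data.Vec using (_∷_; [])
open import Data.Product using (_×_; _,_; proj₁; proj₂; swap)
open import Data.Sum using (_⊎_; inj₁; inj₂)
open import Data.Empty using (⊥-elim)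
open import Relation.Nullary using (¬_; Dec; yes; no; does)
open import Relation.Nullary.Decidable using (_×-dec_)
open import Relation.Binary.PropositionalEquality
  using (_≡_; _≢_; refl; sym; trans; cong; cong₂; ≢-sym; module ≡-Reasoning)
open import Algebra.Properties.Semiring.Sum +-*-semiring
  using (sum; sum-syntax; sum-cong-≗; ∑-comm; ∑-distrib-+; *-distribˡ-sum; *-distribʳ-sum)

private
  variable
    n : ℕ

-- Defined through `does` only, so that it is invariant under Dec.map′
-- (which relates `suc i ∈? s ∷ p` to `i ∈? p`).
indicator : ∀ {p} {P : Set p} → Dec P → ℕ
indicator P? = if does P? then 1 else 0

indicator-yes : ∀ {p} {P : Set p} (P? : Dec P) → P → indicator P? ≡ 1
indicator-yes (yes _) _  = refl
indicator-yes (no ¬p) p = ⊥-elim (¬p p)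

indicator-≤-* : ∀ {p q} {P : Set p} {Q : Set q} {m} (P? : Dec P) (Q? : Dec Q) →
                (P → Q × 1 ≤ m) → indicator P? ≤ indicator Q? * m
indicator-≤-* (no _)  _        _   = z≤n
indicator-≤-* (yes p) (no ¬q)  P⇒Q = ⊥-elim (¬q (proj₁ (P⇒Q p)))
indicator-≤-* {m = m} (yes p) (yes _) P⇒Q =
  ≤-trans (proj₂ (P⇒Q p)) (≤-reflexive (sym (+-identityʳ m)))

indicator-exclusive₃ : ∀ {p q r} {P : Set p} {Q : Set q} {R : Set r}
                       (P? : Dec P) (Q? : Dec Q) (R? : Dec R) →
                       (P → ¬ Q) → (P → ¬ R) → (Q → ¬ R) →
                       indicator P? + indicator Q? + indicator R? ≤ 1
indicator-exclusive₃ (yes p) (yes q) _       P#Q _   _   = ⊥-elim (P#Q p q)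
indicator-exclusive₃ (yes p) _       (yes r) _   P#R _   = ⊥-elim (P#R p r)
indicator-exclusive₃ _       (yes q) (yes r) _   _   Q#R = ⊥-elim (Q#R q r)
indicator-exclusive₃ (yes _) (no _)  (no _)  _   _   _   = s≤s z≤n
indicator-exclusive₃ (no _)  (yes _) (no _)  _   _   _   = s≤s z≤n
indicator-exclusive₃ (no _)  (no _)  (yes _) _   _   _   = s≤s z≤n
indicator-exclusive₃ (no _)  (no _)  (no _)  _   _   _   = z≤n

*-distribˡ-+³ : ∀ m a b c → m * (a + b + c) ≡ m * a + m * b + m * c
*-distribˡ-+³ m a b c = trans (*-distribˡ-+ m (a + b) c) (cong (_+ m * c) (*-distribˡ-+ m a b))

*-distribʳ-+³ : ∀ m a b c → (a + b + c) * m ≡ a * m + b * m + c * m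
*-distribʳ-+³ m a b c = trans (*-distribʳ-+ m (a + b) c) (cong (_+ c * m) (*-distribʳ-+ m a b))

sumFin≡sum : (f : Fin n → ℕ) → sumFin f ≡ sum f
sumFin≡sum {zero}  f = refl
sumFin≡sum {suc n} f = cong (f Fin.zero +_) (sumFin≡sum (λ i → f (Fin.suc i)))

count≡∑indicator : {P : Fin n → Set} (P? : ∀ i → Dec (P i)) →
                   count P? ≡ ∑[ i < n ] indicator (P? i)
count≡∑indicator {zero}  P? = refl
count≡∑indicator {suc n} P? with P? Fin.zero
... | yes _ = cong suc (count≡∑indicator (λ i → P? (Fin.suc i)))
... | no  _ = count≡∑indicator (λ i → P? (Fin.suc i))

∣p∣≡∑indicator : (p : Subset n) → ∣ p ∣ ≡ ∑[ i < n ] indicator (i ∈? p)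
∣p∣≡∑indicator []            = refl
∣p∣≡∑indicator (inside  ∷ p) = cong suc (∣p∣≡∑indicator p)
∣p∣≡∑indicator (outside ∷ p) = ∣p∣≡∑indicator p

sum-mono-≤ : {f g : Fin n → ℕ} → (∀ i → f i ≤ g i) → sum f ≤ sum g
sum-mono-≤ {zero}  f≤g = z≤n
sum-mono-≤ {suc n} f≤g = +-mono-≤ (f≤g Fin.zero) (sum-mono-≤ (λ i → f≤g (Fin.suc i)))

sum-≤-* : ∀ {c} {f : Fin n → ℕ} → (∀ i → f i ≤ c) → sum f ≤ n * c
sum-≤-* {zero}  f≤c = z≤n
sum-≤-* {suc n} f≤c = +-mono-≤ (f≤c Fin.zero) (sum-≤-* (λ i → f≤c (Fin.suc i)))

sum-*-sum : (f g : Fin n → ℕ) → sum f * sum g ≡ ∑[ a < n ] ∑[ b < n ] (f a * g b)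
sum-*-sum f g = trans (*-distribʳ-sum (sum g) f)
                      (sum-cong-≗ (λ a → *-distribˡ-sum (f a) g))

∑³ : (Fin n → Fin n → Fin n → ℕ) → ℕ
∑³ {n} f = ∑[ x < n ] ∑[ y < n ] ∑[ z < n ] f x y z

∑³-cong : {f g : Fin n → Fin n → Fin n → ℕ} →
          (∀ x y z → f x y z ≡ g x y z) → ∑³ f ≡ ∑³ g
∑³-cong f≡g = sum-cong-≗ λ x → sum-cong-≗ λ y → sum-cong-≗ λ z → f≡g x y z

∑³-mono-≤ : {f g : Fin n → Fin n → Fin n → ℕ} →
            (∀ x y z → f x y z ≤ g x y z) → ∑³ f ≤ ∑³ g
∑³-mono-≤ f≤g = sum-mono-≤ λ x → sum-mono-≤ λ y → sum-mono-≤ λ z → f≤g x y z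

∑³-distrib-+ : (f g : Fin n → Fin n → Fin n → ℕ) →
               ∑³ (λ x y z → f x y z + g x y z) ≡ ∑³ f + ∑³ g
∑³-distrib-+ f g =
  trans (sum-cong-≗ λ x →
           trans (sum-cong-≗ λ y → ∑-distrib-+ (f x y) (g x y))
                 (∑-distrib-+ (λ y → sum (f x y)) (λ y → sum (g x y))))
        (∑-distrib-+ (λ x → sum λ y → sum (f x y)) (λ x → sum λ y → sum (g x y)))

∑³-distrib-+³ : (f g h : Fin n → Fin n → Fin n → ℕ) →
                ∑³ (λ x y z → f x y z + g x y z + h x y z) ≡ ∑³ f + ∑³ g + ∑³ h
∑³-distrib-+³ f g h =
  trans (∑³-distrib-+ (λ x y z → f x y z + g x y z) h)
        (cong (_+ ∑³ h) (∑³-distrib-+ f g))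

∑³-swap₁₂ : (f : Fin n → Fin n → Fin n → ℕ) → ∑³ (λ x y z → f y x z) ≡ ∑³ f
∑³-swap₁₂ f = ∑-comm (λ x y → sum (f y x))

∑³-rotate : (f : Fin n → Fin n → Fin n → ℕ) → ∑³ (λ x y z → f z x y) ≡ ∑³ f
∑³-rotate f = trans (sum-cong-≗ λ x → ∑-comm (λ y z → f z x y))
                    (∑-comm (λ x z → sum (f z x)))

ordered? : (x y z : Fin n) → Dec (x Fin.< y × y Fin.< z)
ordered? x y z = (x <? y) ×-dec (y <? z)

ordered : (x y z : Fin n) → ℕ
ordered x y z = indicator (ordered? x y z)

orderings-exclusive : (w a b : Fin n) → ordered w a b + ordered a w b + ordered a b w ≤ 1
orderings-exclusive w a b = indicator-exclusive₃ (ordered? w a b) (ordered? a w b) (ordered? a b w)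
  (λ (w<a , _) (a<w , _) → <-asym w<a a<w)
  (λ (w<a , a<b) (_ , b<w) → <-asym (<-trans w<a a<b) b<w)
  (λ (_ , w<b) (_ , b<w) → <-asym w<b b<w)

∑³-ordered≤∑³ : (f : Fin n → Fin n → Fin n → ℕ) →
                ∑³ (λ x y z → ordered x y z * (f x y z + f y x z + f z x y)) ≤ ∑³ f
∑³-ordered≤∑³ f = begin
  ∑³ (λ x y z → ordered x y z * (f x y z + f y x z + f z x y))
    ≡⟨ ∑³-cong (λ x y z → *-distribˡ-+³ (ordered x y z) (f x y z) (f y x z) (f z x y)) ⟩
  ∑³ (λ x y z → wBelow x y z + wBetween y x z + wAbove z x y)
    ≡⟨ ∑³-distrib-+³ wBelow (λ x y z → wBetween y x z) (λ x y z → wAbove z x y) ⟩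
  ∑³ wBelow + ∑³ (λ x y z → wBetween y x z) + ∑³ (λ x y z → wAbove z x y)
    ≡⟨ cong₂ (λ s t → ∑³ wBelow + s + t) (∑³-swap₁₂ wBetween) (∑³-rotate wAbove) ⟩
  ∑³ wBelow + ∑³ wBetween + ∑³ wAbove
    ≡⟨ sym (∑³-distrib-+³ wBelow wBetween wAbove) ⟩
  ∑³ (λ w a b → wBelow w a b + wBetween w a b + wAbove w a b)
    ≤⟨ ∑³-mono-≤ at-most-once ⟩
  ∑³ f ∎
  where
    open ≤-Reasoning
    wBelow wBetween wAbove : Fin _ → Fin _ → Fin _ → ℕ
    wBelow  w a b = ordered w a b * f w a b
    wBetween w a b = ordered a w b * f w a b
    wAbove   w a b = ordered a b w * f w a b

    at-most-once : ∀ w a b → wBelow w a b + wBetween w a b + wAbove w a b ≤ f w a b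
    at-most-once w a b = begin
      wBelow w a b + wBetween w a b + wAbove w a b
        ≡⟨ sym (*-distribʳ-+³ (f w a b) (ordered w a b) (ordered a w b) (ordered a b w)) ⟩
      (ordered w a b + ordered a w b + ordered a b w) * f w a b
        ≤⟨ *-monoˡ-≤ (f w a b) (orderings-exclusive w a b) ⟩
      1 * f w a b
        ≡⟨ *-identityˡ (f w a b) ⟩
      f w a b ∎

module _ {n} (Γ : Fin n → Subset n) where

  FriendsOf : Fin n → Fin n → Fin n → Set
  FriendsOf w a b = a ∈ Γ w × b ∈ Γ w

  Centred : Fin n → Fin n → Fin n → Set
  Centred x y z = FriendsOf x y z ⊎ FriendsOf y x z ⊎ FriendsOf z x y

  FriendCycle : Fin n → Fin n → Fin n → Set
  FriendCycle x y z = y ∈ Γ x × z ∈ Γ y × x ∈ Γ z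

  Centred-swap₂₃ : ∀ {x y z} → Centred x z y → Centred x y z
  Centred-swap₂₃ (inj₁ x-zy)        = inj₁ (swap x-zy)
  Centred-swap₂₃ (inj₂ (inj₁ z-xy)) = inj₂ (inj₂ z-xy)
  Centred-swap₂₃ (inj₂ (inj₂ y-xz)) = inj₂ (inj₁ y-xz)

  -- Each vertex befriends one of the other two; unless this is a 3-cycle,
  -- two vertices befriend the same third one, and the edge between those two
  -- makes one of them a centre.
  pertinent⇒centred⊎cycle : ∀ {x y z} → Pertinent Γ x y z →
                            Centred x y z ⊎ FriendCycle x y z ⊎ FriendCycle x z y
  pertinent⇒centred⊎cycle (_ , inj₁ y∈Γx , inj₁ x∈Γz , inj₂ z∈Γy) =
    inj₂ (inj₁ (y∈Γx , z∈Γy , x∈Γz))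
  pertinent⇒centred⊎cycle (_ , inj₂ z∈Γx , inj₂ y∈Γz , inj₁ x∈Γy) =
    inj₂ (inj₂ (z∈Γx , y∈Γz , x∈Γy))
  pertinent⇒centred⊎cycle ((_ , inj₁ z∈Γy , _) , _ , inj₁ x∈Γz , inj₁ x∈Γy) =
    inj₁ (inj₂ (inj₁ (x∈Γy , z∈Γy)))
  pertinent⇒centred⊎cycle ((_ , inj₂ y∈Γz , _) , _ , inj₁ x∈Γz , inj₁ x∈Γy) =
    inj₁ (inj₂ (inj₂ (x∈Γz , y∈Γz)))
  pertinent⇒centred⊎cycle ((_ , _ , inj₁ z∈Γx) , inj₁ y∈Γx , inj₂ y∈Γz , _) =
    inj₁ (inj₁ (y∈Γx , z∈Γx))
  pertinent⇒centred⊎cycle ((_ , _ , inj₂ x∈Γz) , inj₁ y∈Γx , inj₂ y∈Γz , _) =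
    inj₁ (inj₂ (inj₂ (x∈Γz , y∈Γz)))
  pertinent⇒centred⊎cycle ((inj₁ y∈Γx , _ , _) , inj₂ z∈Γx , _ , inj₂ z∈Γy) =
    inj₁ (inj₁ (y∈Γx , z∈Γx))
  pertinent⇒centred⊎cycle ((inj₂ x∈Γy , _ , _) , inj₂ z∈Γx , _ , inj₂ z∈Γy) =
    inj₁ (inj₂ (inj₁ (x∈Γy , z∈Γy)))

  bothFriends : Fin n → Fin n → Fin n → ℕ
  bothFriends w a b = indicator (a ∈? Γ w) * indicator (b ∈? Γ w)

  centreWeight : Fin n → Fin n → Fin n → ℕ
  centreWeight x y z = bothFriends x y z + bothFriends y x z + bothFriends z x y

  friendsOf⇒bothFriends≡1 : ∀ {w a b} → FriendsOf w a b → bothFriends w a b ≡ 1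
  friendsOf⇒bothFriends≡1 {w} {a} {b} (a∈Γw , b∈Γw) =
    cong₂ _*_ (indicator-yes (a ∈? Γ w) a∈Γw) (indicator-yes (b ∈? Γ w) b∈Γw)

  centred⇒1≤centreWeight : ∀ {x y z} → Centred x y z → 1 ≤ centreWeight x y z
  centred⇒1≤centreWeight (inj₁ x-yz) =
    ≤-trans (≤-reflexive (sym (friendsOf⇒bothFriends≡1 x-yz)))
            (≤-trans (m≤m+n _ _) (m≤m+n _ _))
  centred⇒1≤centreWeight {x} {y} {z} (inj₂ (inj₁ y-xz)) =
    ≤-trans (≤-reflexive (sym (friendsOf⇒bothFriends≡1 y-xz)))
            (≤-trans (m≤n+m _ (bothFriends x y z)) (m≤m+n _ _))
  centred⇒1≤centreWeight (inj₂ (inj₂ z-xy)) =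
    ≤-trans (≤-reflexive (sym (friendsOf⇒bothFriends≡1 z-xy))) (m≤n+m _ _)

  ∑∑bothFriends≡∣Γ∣² : ∀ w → ∑[ a < n ] ∑[ b < n ] bothFriends w a b ≡ ∣ Γ w ∣ * ∣ Γ w ∣
  ∑∑bothFriends≡∣Γ∣² w = begin
    ∑[ a < n ] ∑[ b < n ] bothFriends w a b
      ≡⟨ sym (sum-*-sum (λ a → indicator (a ∈? Γ w)) (λ b → indicator (b ∈? Γ w))) ⟩
    (∑[ a < n ] indicator (a ∈? Γ w)) * (∑[ b < n ] indicator (b ∈? Γ w))
      ≡⟨ sym (cong₂ _*_ (∣p∣≡∑indicator (Γ w)) (∣p∣≡∑indicator (Γ w))) ⟩
    ∣ Γ w ∣ * ∣ Γ w ∣ ∎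
    where open ≡-Reasoning

  pertinentTriple? : ∀ x y z → Dec (x Fin.< y × y Fin.< z × Pertinent Γ x y z)
  pertinentTriple? x y z = (x <? y) ×-dec (y <? z) ×-dec pertinent? Γ x y z

  numPertinent≡∑³ : numPertinent Γ ≡ ∑³ (λ x y z → indicator (pertinentTriple? x y z))
  numPertinent≡∑³ =
    trans (sumFin≡sum (λ x → sumFin λ y → count (pertinentTriple? x y))) (sum-cong-≗ λ x →
      trans (sumFin≡sum (λ y → count (pertinentTriple? x y)))
            (sum-cong-≗ λ y → count≡∑indicator (pertinentTriple? x y)))

module _ {n} (R : RankingSystem n) (Γ : Fin n → Subset n)
         (concordant : ThreeConcordant R) (friends : IsFriendSets R Γ) where

  friendCycle⇒centred : ∀ {x y z} → x ≢ y → y ≢ z → x ≢ z →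
                        FriendCycle Γ x y z → Centred Γ x y z
  friendCycle⇒centred {x} {y} {z} x≢y y≢z x≢z (y∈Γx , z∈Γy , x∈Γz)
    with z ∈? Γ x | x ∈? Γ y | y ∈? Γ z
  ... | yes z∈Γx | _        | _        = inj₁ (y∈Γx , z∈Γx)
  ... | _        | yes x∈Γy | _        = inj₂ (inj₁ (x∈Γy , z∈Γy))
  ... | _        | _        | yes y∈Γz = inj₂ (inj₂ (x∈Γz , y∈Γz))
  ... | no z∉Γx  | no x∉Γy  | no y∉Γz  =
    ⊥-elim (concordant x y z x≢y y≢z x≢z
      ( precedes y∈Γx z∉Γx (≢-sym x≢z)
      , precedes z∈Γy x∉Γy x≢y
      , precedes x∈Γz y∉Γz y≢z ))
    where
      precedes : ∀ {u v w} → v ∈ Γ u → w ∉ Γ u → w ≢ u → _≺[_]_ R v u w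
      precedes = proj₂ friends _ _ _

  pertinent⇒centred : ∀ {x y z} → x ≢ y → y ≢ z → x ≢ z →
                      Pertinent Γ x y z → Centred Γ x y z
  pertinent⇒centred x≢y y≢z x≢z pertinent with pertinent⇒centred⊎cycle Γ pertinent
  ... | inj₁ centred        = centred
  ... | inj₂ (inj₁ x→y→z→x) = friendCycle⇒centred x≢y y≢z x≢z x→y→z→x
  ... | inj₂ (inj₂ x→z→y→x) =
    Centred-swap₂₃ Γ (friendCycle⇒centred x≢z (≢-sym y≢z) x≢y x→z→y→x)

  pertinentTriple≤centreWeight : ∀ x y z →
    indicator (pertinentTriple? Γ x y z) ≤ ordered x y z * centreWeight Γ x y z
  pertinentTriple≤centreWeight x y z =
    indicator-≤-* (pertinentTriple? Γ x y z) (ordered? x y z)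
      λ (x<y , y<z , pertinent) →
        (x<y , y<z) ,
        centred⇒1≤centreWeight Γ
          (pertinent⇒centred (<⇒≢ x<y) (<⇒≢ y<z) (<⇒≢ (<-trans x<y y<z)) pertinent)

proposition4p3 : (n K : ℕ) (R : RankingSystem n) (Γ : Fin n → Subset n) → ThreeConcordant R → IsFriendSets R Γ → (∀ x → ∣ Γ x ∣ ≤ K) → numPertinent Γ ≤ n * (K * K)
proposition4p3 n K R Γ concordant friends ∣Γ∣≤K = begin
  numPertinent Γ
    ≡⟨ numPertinent≡∑³ Γ ⟩
  ∑³ (λ x y z → indicator (pertinentTriple? Γ x y z))
    ≤⟨ ∑³-mono-≤ (pertinentTriple≤centreWeight R Γ concordant friends) ⟩
  ∑³ (λ x y z → ordered x y z * centreWeight Γ x y z)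
    ≤⟨ ∑³-ordered≤∑³ (bothFriends Γ) ⟩
  ∑³ (bothFriends Γ)
    ≡⟨ sum-cong-≗ (∑∑bothFriends≡∣Γ∣² Γ) ⟩
  ∑[ w < n ] (∣ Γ w ∣ * ∣ Γ w ∣)
    ≤⟨ sum-≤-* (λ w → *-mono-≤ (∣Γ∣≤K w) (∣Γ∣≤K w)) ⟩
  n * (K * K) ∎
  where open ≤-Reasoning
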